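{- Let $n\ge1$, $1\le k\le n$, and let $M=M_{n,k}^{T}=(m_{i,j})_{0\le i,j\le n-1}$ be the transpose cyclic matrix, with $S_{i,j}=\sum_{l=0}^{j}m_{i,l}$. For a column $C_j$ ($0\le j\le n-1$), let $i=i(j)$ be the row index of the last entry of the first (topmost) maximal run of consecutive entries equal to $1$ in $C_j$. Then $S_{0,j}=S_{1,j}=\cdots=S_{i,j}$, and, if $i<n-1$, $S_{i,j}=S_{i+1,j}+1$ and $S_{i+1,j}=S_{i+2,j}=\cdots=S_{n-1,j}$.
   Context: The entry $(i,j)$ ($0\le i,j\le n-1$) of the transpose cyclic matrix $M_{n,k}^T$ equals $1$ iff $i\equiv jk+a\pmod n$ for some $0\le a\le k-1$, and $0$ otherwise; thus the ones in each column form one cyclic block of length $k$, appearing either as a single linear block or as an initial block starting at row $0$ together with a terminal block ending at row $n-1$. -}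

module Defs where

open import Data.Nat using (ℕ; zero; suc; _+_; _*_; _≡ᵇ_; _<_; _≤_; NonZero)
open import Data.Nat.DivMod using (_%_)
open import Data.Bool using (Bool; true; false; _∨_; if_then_else_)
open import Data.Product using (_×_)
open import Data.Sum using (_⊎_)
open import Relation.Binary.PropositionalEquality using (_≡_)

inBlock : (n : ℕ) .{{_ : NonZero n}} → (k i j a : ℕ) → Bool
inBlock n k i j zero    = false
inBlock n k i j (suc a) = (i ≡ᵇ ((j * k + a) % n)) ∨ inBlock n k i j a

-- entry (i , j) of the transpose cyclic matrix M_{n,k}^T :
-- 1 iff i ≡ j k + a (mod n) for some 0 ≤ a ≤ k-1, else 0
-- (rows i are in 0..n-1, so "i ≡ x mod n" is  i = x % n)
m : (n : ℕ) .{{_ : NonZero n}} → (k i j : ℕ) → ℕ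
m n k i j = if inBlock n k i j k then 1 else 0

S : (n : ℕ) .{{_ : NonZero n}} → (k i j : ℕ) → ℕ
S n k i zero    = m n k i zero
S n k i (suc j) = S n k i j + m n k i (suc j)

IsEndOfFirstRun : (n : ℕ) .{{_ : NonZero n}} → (k j i : ℕ) → Set
IsEndOfFirstRun n k j i =
  Data.Product.Σ ℕ λ r0 →
    (r0 ≤ i) × (i < n)
    × (∀ r → r < r0 → m n k r j ≡ 0)
    × (∀ r → r0 ≤ r → r ≤ i → m n k r j ≡ 1)
    × ((suc i ≡ n) ⊎ (m n k (suc i) j ≡ 0))

{-# OPTIONS --safe #-}
module Submission where

-- Row r of S counts the l < (j+1)k with l ≡ r (mod n), since for k ≤ n the k
-- residues in a column of M are distinct.  Writing (j+1)k = Q′n + e, column j of S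
-- is therefore Q′ + 1 on the rows r < e and Q′ on the others, so it remains to see
-- that the first run of ones in column j of M ends at row e - 1, or at row n - 1
-- when e = 0.  This follows by comparing column j of M with the difference of the
-- counts up to jk = Qn + s and up to (j+1)k.

open import Defs
open import Data.Bool using (Bool; true; false; T; _∨_; if_then_else_)
open import Data.Bool.Properties using (T-∨)
open import Data.Empty using (⊥; ⊥-elim)
open import Data.Unit using (tt)
open import Data.Nat
open import Data.Nat.Properties
open import Data.Nat.DivMod
open import Data.Nat.Divisibility using (_∣_; n∣m*n; ∣m+n∣m⇒∣n; ∣⇒≤)
open import Data.Product using (_×_; _,_; ∃)
open import Data.Sum using (inj₁; inj₂; fromInj₂)
open import Function.Bundles using (Equivalence)
open import Relation.Nullary using (yes; no)
open import Relation.Binary.PropositionalEquality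
open import Algebra.Properties.CommutativeSemigroup +-commutativeSemigroup using (x∙yz≈y∙xz)
open ≡-Reasoning

≤-pred-≡ : ∀ {t i n} → suc i ≡ n → t < n → t ≤ i
≤-pred-≡ refl = m<1+n⇒m≤n

χ : Bool → ℕ
χ b = if b then 1 else 0

χ-T : ∀ {b} → T b → χ b ≡ 1
χ-T {true} _ = refl

χ≡suc⇒T : ∀ {b c} → χ b ≡ suc c → T b
χ≡suc⇒T {true} _ = tt

χ+χ≡2⇒T : ∀ b c → χ b + χ c ≡ 2 → T b
χ+χ≡2⇒T true  _     _  = tt
χ+χ≡2⇒T false false ()
χ+χ≡2⇒T false true  ()

χ-∨ : ∀ b c → (T b → T c → ⊥) → χ (b ∨ c) ≡ χ b + χ c
χ-∨ false _     _        = refl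
χ-∨ true  false _        = refl
χ-∨ true  true  disjoint = ⊥-elim (disjoint tt tt)

χ-<ᵇ : ∀ {r t} → r < t → χ (r <ᵇ t) ≡ 1
χ-<ᵇ r<t = χ-T (<⇒<ᵇ r<t)

χ-≮ᵇ : ∀ {r t} → t ≤ r → χ (r <ᵇ t) ≡ 0
χ-≮ᵇ {r} {t} t≤r with r <ᵇ t in eq
... | false = refl
... | true  = ⊥-elim (<⇒≱ (<ᵇ⇒< r t (subst T (sym eq) tt)) t≤r)

χ-<ᵇ≡0⇒≥ : ∀ {r t} → χ (r <ᵇ t) ≡ 0 → t ≤ r
χ-<ᵇ≡0⇒≥ {r} {t} eq with r <? t
... | yes r<t = ⊥-elim (0≢1+n (trans (sym eq) (χ-<ᵇ r<t)))
... | no  r≮t = ≮⇒≥ r≮t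

χ-<ᵇ-suc : ∀ r t → χ (r <ᵇ suc t) ≡ χ (r <ᵇ t) + χ (r ≡ᵇ t)
χ-<ᵇ-suc zero    zero    = refl
χ-<ᵇ-suc zero    (suc t) = refl
χ-<ᵇ-suc (suc r) zero    = refl
χ-<ᵇ-suc (suc r) (suc t) = χ-<ᵇ-suc r t

χ-suc-<ᵇ : ∀ r t → χ (r <ᵇ t) ≡ χ (suc r <ᵇ t) + χ (suc r ≡ᵇ t)
χ-suc-<ᵇ r zero    = refl
χ-suc-<ᵇ r (suc t) = χ-<ᵇ-suc r t

module _ (n : ℕ) .{{_ : NonZero n}} where

  %-/-unique : ∀ {t} q → t < n → (t + q * n) % n ≡ t × (t + q * n) / n ≡ q
  %-/-unique {t} q t<n = %≡ , /≡
    where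
    %≡ : (t + q * n) % n ≡ t
    %≡ = trans ([m+kn]%n≡m%n t q n) (m<n⇒m%n≡m t<n)
    /≡ : (t + q * n) / n ≡ q
    /≡ = begin
      (t + q * n) / n   ≡⟨ +-distrib-/-∣ʳ t (n∣m*n q) ⟩
      t / n + q * n / n ≡⟨ cong₂ _+_ (m<n⇒m/n≡0 t<n) (m*n/n≡m q n) ⟩
      q                 ∎

  suc≡suc%+/ : ∀ N → suc N ≡ suc (N % n) + N / n * n
  suc≡suc%+/ N = cong suc (m≡m%n+[m/n]*n N n)

  suc-%-/-< : ∀ N → suc (N % n) < n → suc N % n ≡ suc (N % n) × suc N / n ≡ N / n
  suc-%-/-< N lt rewrite suc≡suc%+/ N = %-/-unique (N / n) lt

  suc-%-/-≡ : ∀ N → suc (N % n) ≡ n → suc N % n ≡ 0 × suc N / n ≡ suc (N / n)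
  suc-%-/-≡ N eq = subst (λ M → M % n ≡ 0 × M / n ≡ suc (N / n)) (sym wraps)
                           (%-/-unique (suc (N / n)) (>-nonZero⁻¹ n))
    where
    wraps : suc N ≡ 0 + suc (N / n) * n
    wraps = trans (suc≡suc%+/ N) (cong (_+ N / n * n) eq)

  %-shift-≢ : ∀ y d → suc d < n → (y + suc d) % n ≢ y % n
  %-shift-≢ y d d<n eq = <⇒≱ d<n (∣⇒≤ n∣d)
    where
    quotients : y / n * n + suc d ≡ (y + suc d) / n * n
    quotients = +-cancelˡ-≡ (y % n) _ _ (begin
      y % n + (y / n * n + suc d)       ≡⟨ +-assoc (y % n) _ _ ⟨
      y % n + y / n * n + suc d         ≡⟨ cong (_+ suc d) (m≡m%n+[m/n]*n y n) ⟨
      y + suc d                         ≡⟨ m≡m%n+[m/n]*n (y + suc d) n ⟩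
      (y + suc d) % n + (y + suc d) / n * n ≡⟨ cong (_+ (y + suc d) / n * n) eq ⟩
      y % n + (y + suc d) / n * n       ∎)
    n∣d : n ∣ suc d
    n∣d = ∣m+n∣m⇒∣n (subst (n ∣_) (sym quotients) (n∣m*n ((y + suc d) / n))) (n∣m*n (y / n))

  %-window-injective : ∀ x {b a} → b < a → a < n → (x + b) % n ≢ (x + a) % n
  %-window-injective x {b} b<a a<n eq with m≤n⇒∃[o]m+o≡n b<a
  ... | d , refl = %-shift-≢ (x + b) d (≤-<-trans (s≤s (m≤n+m d b)) a<n) (begin
    (x + b + suc d) % n   ≡⟨ cong (_% n) (+-assoc x b (suc d)) ⟩
    (x + (b + suc d)) % n ≡⟨ cong (λ z → (x + z) % n) (+-suc b d) ⟩
    (x + suc (b + d)) % n ≡⟨ sym eq ⟩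
    (x + b) % n           ∎)

  /+χ<%-suc : ∀ {r} → r < n → ∀ N → N / n + χ (r <ᵇ suc (N % n)) ≡ suc N / n + χ (r <ᵇ suc N % n)
  /+χ<%-suc {r} r<n N with m≤n⇒m<n∨m≡n (m%n<n N n)
  ... | inj₁ lt with suc-%-/-< N lt
  ...   | %≡ , /≡ = cong₂ (λ q t → q + χ (r <ᵇ t)) (sym /≡) (sym %≡)
  /+χ<%-suc {r} r<n N | inj₂ eq with suc-%-/-≡ N eq
  ...   | %≡ , /≡ = begin
    N / n + χ (r <ᵇ suc (N % n))   ≡⟨ cong (λ t → N / n + χ (r <ᵇ t)) eq ⟩
    N / n + χ (r <ᵇ n)             ≡⟨ cong (N / n +_) (χ-<ᵇ r<n) ⟩
    N / n + 1                      ≡⟨ +-comm (N / n) 1 ⟩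
    suc (N / n)                    ≡⟨ +-identityʳ (suc (N / n)) ⟨
    suc (N / n) + 0                ≡⟨ cong₂ (λ q t → q + χ (r <ᵇ t)) (sym /≡) (sym %≡) ⟩
    suc N / n + χ (r <ᵇ suc N % n) ∎

  count : ℕ → ℕ → ℕ
  count r zero    = 0
  count r (suc N) = count r N + χ (r ≡ᵇ N % n)

  count-closed : ∀ {r} → r < n → ∀ N → count r N ≡ N / n + χ (r <ᵇ N % n)
  count-closed {r} r<n zero =
    sym (cong₂ (λ q t → q + χ (r <ᵇ t)) (0/n≡0 n) (m<n⇒m%n≡m (>-nonZero⁻¹ n)))
  count-closed {r} r<n (suc N) = begin
    count r N + χ (r ≡ᵇ N % n)                ≡⟨ cong (_+ χ (r ≡ᵇ N % n)) (count-closed r<n N) ⟩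
    N / n + χ (r <ᵇ N % n) + χ (r ≡ᵇ N % n)   ≡⟨ +-assoc (N / n) _ _ ⟩
    N / n + (χ (r <ᵇ N % n) + χ (r ≡ᵇ N % n)) ≡⟨ cong (N / n +_) (χ-<ᵇ-suc r (N % n)) ⟨
    N / n + χ (r <ᵇ suc (N % n))              ≡⟨ /+χ<%-suc r<n N ⟩
    suc N / n + χ (r <ᵇ suc N % n)            ∎

  module _ (k : ℕ) where

    inBlock-witness : ∀ {r j} a → T (inBlock n k r j a) → ∃ λ b → b < a × r ≡ (j * k + b) % n
    inBlock-witness {r} {j} (suc a) hit with Equivalence.to T-∨ hit
    ... | inj₁ here  = a , n<1+n a , ≡ᵇ⇒≡ r _ here
    ... | inj₂ there with inBlock-witness a there
    ...   | b , b<a , eq = b , m<n⇒m<1+n b<a , eq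

    count-inBlock : ∀ r j a → a ≤ n → count r (j * k + a) ≡ count r (j * k) + χ (inBlock n k r j a)
    count-inBlock r j zero _ = trans (cong (count r) (+-identityʳ (j * k))) (sym (+-identityʳ _))
    count-inBlock r j (suc a) a<n = begin
      count r (j * k + suc a)                  ≡⟨ cong (count r) (+-suc (j * k) a) ⟩
      count r (j * k + a) + χ new              ≡⟨ cong (_+ χ new) (count-inBlock r j a (<⇒≤ a<n)) ⟩
      count r (j * k) + χ old + χ new          ≡⟨ +-assoc (count r (j * k)) (χ old) (χ new) ⟩
      count r (j * k) + (χ old + χ new)        ≡⟨ cong (count r (j * k) +_) (+-comm (χ old) (χ new)) ⟩
      count r (j * k) + (χ new + χ old)        ≡⟨ cong (count r (j * k) +_) (χ-∨ new old disjoint) ⟨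
      count r (j * k) + χ (new ∨ old)          ∎
      where
      new old : Bool
      new = r ≡ᵇ (j * k + a) % n
      old = inBlock n k r j a
      disjoint : T new → T old → ⊥
      disjoint hit hit′ with inBlock-witness a hit′
      ... | b , b<a , eq = %-window-injective (j * k) b<a a<n (trans (sym eq) (≡ᵇ⇒≡ r _ hit))

    S≡count : k ≤ n → ∀ r j → S n k r j ≡ count r (j * k + k)
    S≡count k≤n r zero    = sym (count-inBlock r 0 k k≤n)
    S≡count k≤n r (suc j) = begin
      S n k r j + m n k r (suc j)              ≡⟨ cong (_+ m n k r (suc j)) (S≡count k≤n r j) ⟩
      count r (j * k + k) + m n k r (suc j)    ≡⟨ cong (λ x → count r x + m n k r (suc j)) (+-comm (j * k) k) ⟩
      count r (suc j * k) + m n k r (suc j)    ≡⟨ count-inBlock r (suc j) k k≤n ⟨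
      count r (suc j * k + k)                  ∎

  module Column (k : ℕ) (k≤n : k ≤ n) (j : ℕ) where

    Q s Q′ e : ℕ
    Q  = j * k / n
    s  = j * k % n
    Q′ = (j * k + k) / n
    e  = (j * k + k) % n

    S-closed : ∀ {r} → r < n → S n k r j ≡ Q′ + χ (r <ᵇ e)
    S-closed r<n = trans (S≡count k k≤n _ j) (count-closed r<n (j * k + k))

    S-above : ∀ {r} → r < e → S n k r j ≡ suc Q′
    S-above r<e =
      trans (S-closed (<-trans r<e (m%n<n _ n))) (trans (cong (Q′ +_) (χ-<ᵇ r<e)) (+-comm Q′ 1))

    S-below : ∀ {r} → e ≤ r → r < n → S n k r j ≡ Q′
    S-below e≤r r<n = trans (S-closed r<n) (trans (cong (Q′ +_) (χ-≮ᵇ e≤r)) (+-identityʳ Q′))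

    column-equation : ∀ {r} → r < n → m n k r j + (Q + χ (r <ᵇ s)) ≡ Q′ + χ (r <ᵇ e)
    column-equation {r} r<n = begin
      m n k r j + (Q + χ (r <ᵇ s))  ≡⟨ cong (m n k r j +_) (count-closed r<n (j * k)) ⟨
      m n k r j + count r (j * k)   ≡⟨ +-comm (m n k r j) (count r (j * k)) ⟩
      count r (j * k) + m n k r j   ≡⟨ count-inBlock k r j k k≤n ⟨
      count r (j * k + k)           ≡⟨ count-closed r<n (j * k + k) ⟩
      Q′ + χ (r <ᵇ e)               ∎

    -- Subtracting the column equations at row i (a one) and row i + 1 (a zero)
    -- leaves [i + 1 = e] = 1 + [i + 1 = s].
    runEnd-interior : ∀ {i} → IsEndOfFirstRun n k j i → suc i < n → e ≡ suc i
    runEnd-interior {i} (r₀ , r₀≤i , i<n , _ , ones , end) si<n =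
      sym (≡ᵇ⇒≡ (suc i) e (χ≡suc⇒T jump))
      where
      a c b d : ℕ
      a = χ (suc i <ᵇ s)
      c = χ (suc i ≡ᵇ s)
      b = χ (suc i <ᵇ e)
      d = χ (suc i ≡ᵇ e)
      at-i : suc (Q + (a + c)) ≡ Q′ + (b + d)
      at-i = begin
        suc (Q + (a + c))             ≡⟨ cong (λ z → suc (Q + z)) (χ-suc-<ᵇ i s) ⟨
        suc (Q + χ (i <ᵇ s))          ≡⟨ cong (_+ (Q + χ (i <ᵇ s))) (ones i r₀≤i ≤-refl) ⟨
        m n k i j + (Q + χ (i <ᵇ s))  ≡⟨ column-equation i<n ⟩
        Q′ + χ (i <ᵇ e)               ≡⟨ cong (Q′ +_) (χ-suc-<ᵇ i e) ⟩
        Q′ + (b + d)                  ∎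
      after-i : Q + a ≡ Q′ + b
      after-i = trans (cong (_+ (Q + a)) (sym zero-after-i)) (column-equation si<n)
        where
        zero-after-i : m n k (suc i) j ≡ 0
        zero-after-i = fromInj₂ (λ si≡n → ⊥-elim (<-irrefl si≡n si<n)) end
      jump : d ≡ suc c
      jump = +-cancelˡ-≡ (Q′ + b) d (suc c) (begin
        Q′ + b + d         ≡⟨ +-assoc Q′ b d ⟩
        Q′ + (b + d)       ≡⟨ at-i ⟨
        suc (Q + (a + c))  ≡⟨ cong suc (+-assoc Q a c) ⟨
        suc (Q + a + c)    ≡⟨ cong (λ z → suc (z + c)) after-i ⟩
        suc (Q′ + b + c)   ≡⟨ +-suc (Q′ + b) c ⟨
        Q′ + b + suc c     ∎)

    quotient-wraps : ∀ {i} → IsEndOfFirstRun n k j i → suc i ≡ n → Q′ ≡ suc Q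
    quotient-wraps {i} (r₀ , r₀≤i , i<n , _ , ones , _) si≡n = begin
      Q′                            ≡⟨ +-identityʳ Q′ ⟨
      Q′ + 0                        ≡⟨ cong (Q′ +_) (χ-≮ᵇ (≤-pred-≡ si≡n (m%n<n _ n))) ⟨
      Q′ + χ (i <ᵇ e)               ≡⟨ column-equation i<n ⟨
      m n k i j + (Q + χ (i <ᵇ s))  ≡⟨ cong₂ (λ x y → x + (Q + y)) (ones i r₀≤i ≤-refl)
                                               (χ-≮ᵇ (≤-pred-≡ si≡n (m%n<n _ n))) ⟩
      suc (Q + 0)                   ≡⟨ cong suc (+-identityʳ Q) ⟩
      suc Q                         ∎

    wrapped-column : Q′ ≡ suc Q → ∀ {r} → r < n → m n k r j + χ (r <ᵇ s) ≡ suc (χ (r <ᵇ e))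
    wrapped-column Q′≡ {r} r<n = +-cancelˡ-≡ Q _ _ (begin
      Q + (m n k r j + χ (r <ᵇ s))  ≡⟨ x∙yz≈y∙xz Q (m n k r j) (χ (r <ᵇ s)) ⟩
      m n k r j + (Q + χ (r <ᵇ s))  ≡⟨ column-equation r<n ⟩
      Q′ + χ (r <ᵇ e)               ≡⟨ cong (_+ χ (r <ᵇ e)) Q′≡ ⟩
      suc Q + χ (r <ᵇ e)            ≡⟨ +-suc Q (χ (r <ᵇ e)) ⟨
      Q + suc (χ (r <ᵇ e))          ∎)

    remainders-agree⇒k≡n : Q′ ≡ suc Q → e ≡ s → k ≡ n
    remainders-agree⇒k≡n Q′≡ e≡s = +-cancelˡ-≡ (j * k) k n (begin
      j * k + k        ≡⟨ m≡m%n+[m/n]*n (j * k + k) n ⟩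
      e + Q′ * n       ≡⟨ cong₂ (λ t q → t + q * n) e≡s Q′≡ ⟩
      s + (n + Q * n)  ≡⟨ cong (s +_) (+-comm n (Q * n)) ⟩
      s + (Q * n + n)  ≡⟨ +-assoc s (Q * n) n ⟨
      s + Q * n + n    ≡⟨ cong (_+ n) (m≡m%n+[m/n]*n (j * k) n) ⟨
      j * k + n        ∎)

    -- Row n - 1 forces Q′ = Q + 1.  If e > 0, row 0 is then a one, so the whole
    -- column is; rows s and e give s = e, hence k = n and s = 0.
    runEnd-last : ∀ {i} → IsEndOfFirstRun n k j i → suc i ≡ n → e ≡ 0
    runEnd-last {i} run@(r₀ , _ , _ , above , ones , _) si≡n with 0 <? e
    ... | no  0≮e = n≤0⇒n≡0 (≮⇒≥ 0≮e)
    ... | yes 0<e = begin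
      e          ≡⟨ e≡s ⟩
      s          ≡⟨ cong (λ k′ → j * k′ % n) (remainders-agree⇒k≡n Q′≡ e≡s) ⟩
      j * n % n  ≡⟨ m*n%n≡0 j n ⟩
      0          ∎
      where
      Q′≡ : Q′ ≡ suc Q
      Q′≡ = quotient-wraps run si≡n
      wrapped : ∀ {r} → r < n → m n k r j + χ (r <ᵇ s) ≡ suc (χ (r <ᵇ e))
      wrapped = wrapped-column Q′≡
      top-one : m n k 0 j ≡ 1
      top-one = χ-T (χ+χ≡2⇒T _ _ (trans (wrapped (>-nonZero⁻¹ n)) (cong suc (χ-<ᵇ 0<e))))
      all-ones : ∀ {r} → r < n → m n k r j ≡ 1
      all-ones r<n = ones _ (≤-trans r₀≤0 z≤n) (≤-pred-≡ si≡n r<n)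
        where
        r₀≤0 : r₀ ≤ 0
        r₀≤0 = ≮⇒≥ (λ 0<r₀ → 0≢1+n (trans (sym (above 0 0<r₀)) top-one))
      e≤s : e ≤ s
      e≤s = χ-<ᵇ≡0⇒≥ (suc-injective (begin
        suc (χ (s <ᵇ e))       ≡⟨ wrapped (m%n<n _ n) ⟨
        m n k s j + χ (s <ᵇ s) ≡⟨ cong₂ _+_ (all-ones (m%n<n _ n)) (χ-≮ᵇ {s} ≤-refl) ⟩
        1                      ∎))
      s≤e : s ≤ e
      s≤e = χ-<ᵇ≡0⇒≥ (suc-injective (begin
        suc (χ (e <ᵇ s))       ≡⟨ cong (_+ χ (e <ᵇ s)) (all-ones (m%n<n _ n)) ⟨
        m n k e j + χ (e <ᵇ s) ≡⟨ wrapped (m%n<n _ n) ⟩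
        suc (χ (e <ᵇ e))       ≡⟨ cong suc (χ-≮ᵇ {e} ≤-refl) ⟩
        1                      ∎))
      e≡s : e ≡ s
      e≡s = ≤-antisym e≤s s≤e

lemma5p2 : (n : ℕ) .{{_ : NonZero n}} → (k : ℕ) → 1 ≤ k → k ≤ n →
    (j : ℕ) → j < n → (i : ℕ) → IsEndOfFirstRun n k j i →
      (∀ r → r ≤ i → S n k r j ≡ S n k 0 j)
      × (suc i < n →
          (S n k i j ≡ S n k (suc i) j + 1)
          × (∀ r → suc i ≤ r → r < n → S n k r j ≡ S n k (suc i) j))
lemma5p2 n k _ k≤n j _ i run@(_ , _ , i<n , _) = rows-up-to-i , rows-after-i
  where
  open Column n k k≤n j
  rows-up-to-i : ∀ r → r ≤ i → S n k r j ≡ S n k 0 j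
  rows-up-to-i r r≤i with m≤n⇒m<n∨m≡n i<n
  ... | inj₁ si<n = trans (S-above (subst (r <_) e≡ (s≤s r≤i))) (sym (S-above (subst (0 <_) e≡ z<s)))
    where e≡ : suc i ≡ e
          e≡ = sym (runEnd-interior run si<n)
  ... | inj₂ si≡n = trans (S-below (e≤ r) (≤-<-trans r≤i i<n)) (sym (S-below (e≤ 0) (>-nonZero⁻¹ n)))
    where e≤ : ∀ t → e ≤ t
          e≤ t = subst (_≤ t) (sym (runEnd-last run si≡n)) z≤n
  rows-after-i : suc i < n → (S n k i j ≡ S n k (suc i) j + 1)
                 × (∀ r → suc i ≤ r → r < n → S n k r j ≡ S n k (suc i) j)
  rows-after-i si<n = step , flat
    where
    e≡ : e ≡ suc i
    e≡ = runEnd-interior run si<n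
    S-after-i : ∀ {r} → suc i ≤ r → r < n → S n k r j ≡ Q′
    S-after-i si≤r = S-below (subst (_≤ _) (sym e≡) si≤r)
    step : S n k i j ≡ S n k (suc i) j + 1
    step = trans (S-above (subst (i <_) (sym e≡) ≤-refl))
                 (trans (+-comm 1 Q′) (cong (_+ 1) (sym (S-after-i ≤-refl si<n))))
    flat : ∀ r → suc i ≤ r → r < n → S n k r j ≡ S n k (suc i) j
    flat r si≤r r<n = trans (S-after-i si≤r r<n) (sym (S-after-i ≤-refl si<n))
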